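{- If $\mathrm{CHA}\vdash\Gamma\Rightarrow\delta$, then there exists an injective $\mathrm{CHA}$-proof of $\Gamma\Rightarrow\delta$, i.e. a $\mathrm{CHA}$-proof $((T,\beta),\rho)$ in which the bud-to-companion map $\beta$ is injective.
   Context: Language: first-order arithmetic (terms from variables, $0,S,+,\cdot$); sequents $\Gamma\Rightarrow\delta$ with $\Gamma$ a finite set and $\delta$ a formula. $\mathrm{CHA}$ rules: standard intuitionistic sequent calculus rules for first-order logic with equality, weakening (from $\Gamma\Rightarrow\delta$ infer $\Gamma,\Gamma'\Rightarrow\delta$), cut, the arithmetic axioms ($\Rightarrow0\neq St$, $Ss=St\Rightarrow s=t$, $\Rightarrow s+0=s$, $\Rightarrow s+St=S(s+t)$, $\Rightarrow s\cdot0=0$, $\Rightarrow s\cdot St=(s\cdot t)+s$), and $\textsc{Case}_x$ (from $\Gamma[0/x]\Rightarrow\delta[0/x]$ and $\Gamma[Sx/x]\Rightarrow\delta[Sx/x]$ infer $\Gamma\Rightarrow\delta$). A pre-proof is $((T,\beta),\rho)$ with $T$ a finite tree, $\beta$ a partial map from leaves (buds) to inner nodes (companions), $\rho$ assigning rule instances to non-bud nodes whose premises label the children, buds labelled by their companion's sequent. An infinite branch starts at the root, each step to a child or from a bud to its companion. A $\mathrm{CHA}$-proof is a pre-proof such that along every infinite branch some variable $x$ is, from some point on, free in every sequent and the branch passes instances of $\textsc{Case}_x$ infinitely often. $\mathrm{CHA}\vdash\Gamma\Rightarrow\delta$: some $\mathrm{CHA}$-proof has root sequent $\Gamma\Rightarrow\delta$.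 -}

module Defs where

open import Data.Nat using (ℕ; _≤_; _≡ᵇ_)
open import Data.Bool using (if_then_else_)
open import Data.Fin using (Fin)
open import Data.List using (List; []; _∷_; _++_; map; length; lookup)
open import Data.List.Membership.Propositional using (_∈_)
open import Data.List.Relation.Unary.Any using (Any)
open import Data.List.Relation.Binary.Pointwise using (Pointwise)
open import Data.Product using (Σ; ∃; _×_; _,_)
open import Data.Sum using (_⊎_)
open import Data.Unit using (⊤)
open import Data.Empty using (⊥)
open import Relation.Nullary using (¬_)
open import Relation.Binary.PropositionalEquality using (_≡_; _≢_)

data Term : Set where
  var  : ℕ → Term
  `0   : Term
  `S   : Term → Term
  _`+_ : Term → Term → Term
  _`·_ : Term → Term → Term

infix 6 _≐_
infixr 5 _∧'_ _∨'_
infixr 4 _⇒'_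

data Formula : Set where
  _≐_  : Term → Term → Formula
  ⊥'   : Formula
  _∧'_ : Formula → Formula → Formula
  _∨'_ : Formula → Formula → Formula
  _⇒'_ : Formula → Formula → Formula
  ∀'   : ℕ → Formula → Formula
  ∃'   : ℕ → Formula → Formula

_≠_ : Term → Term → Formula
s ≠ t = (s ≐ t) ⇒' ⊥'

FreeInT : ℕ → Term → Set
FreeInT x (var y)   = x ≡ y
FreeInT x `0        = ⊥
FreeInT x (`S t)    = FreeInT x t
FreeInT x (s `+ t)  = FreeInT x s ⊎ FreeInT x t
FreeInT x (s `· t)  = FreeInT x s ⊎ FreeInT x t

FreeInF : ℕ → Formula → Set
FreeInF x (s ≐ t)  = FreeInT x s ⊎ FreeInT x t
FreeInF x ⊥'       = ⊥
FreeInF x (φ ∧' ψ) = FreeInF x φ ⊎ FreeInF x ψ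
FreeInF x (φ ∨' ψ) = FreeInF x φ ⊎ FreeInF x ψ
FreeInF x (φ ⇒' ψ) = FreeInF x φ ⊎ FreeInF x ψ
FreeInF x (∀' y φ) = ¬ (x ≡ y) × FreeInF x φ
FreeInF x (∃' y φ) = ¬ (x ≡ y) × FreeInF x φ

FreeInCtx : ℕ → List Formula → Set
FreeInCtx x Γ = Any (FreeInF x) Γ

substT : Term → ℕ → Term → Term
substT t x (var y)  = if x ≡ᵇ y then t else var y
substT t x `0       = `0
substT t x (`S u)   = `S (substT t x u)
substT t x (u `+ w) = substT t x u `+ substT t x w
substT t x (u `· w) = substT t x u `· substT t x w

substF : Term → ℕ → Formula → Formula
substF t x (u ≐ w)  = substT t x u ≐ substT t x w
substF t x ⊥'       = ⊥'
substF t x (φ ∧' ψ) = substF t x φ ∧' substF t x ψ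
substF t x (φ ∨' ψ) = substF t x φ ∨' substF t x ψ
substF t x (φ ⇒' ψ) = substF t x φ ⇒' substF t x ψ
substF t x (∀' y φ) = if x ≡ᵇ y then ∀' y φ else ∀' y (substF t x φ)
substF t x (∃' y φ) = if x ≡ᵇ y then ∃' y φ else ∃' y (substF t x φ)

substC : Term → ℕ → List Formula → List Formula
substC t x Γ = map (substF t x) Γ

FreeFor : Term → ℕ → Formula → Set
FreeFor t x (u ≐ w)  = ⊤
FreeFor t x ⊥'       = ⊤
FreeFor t x (φ ∧' ψ) = FreeFor t x φ × FreeFor t x ψ
FreeFor t x (φ ∨' ψ) = FreeFor t x φ × FreeFor t x ψ
FreeFor t x (φ ⇒' ψ) = FreeFor t x φ × FreeFor t x ψ
FreeFor t x (∀' y φ) = ¬ FreeInF x (∀' y φ) ⊎ (¬ FreeInT y t × FreeFor t x φ)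
FreeFor t x (∃' y φ) = ¬ FreeInF x (∃' y φ) ⊎ (¬ FreeInT y t × FreeFor t x φ)

-- Sequents  Γ ⇒ δ ; Γ is a finite set, represented by a list taken
-- up to the set equivalence _≈_ below.

infix 2 _⊢_
record Seq : Set where
  constructor _⊢_
  field
    ctx  : List Formula
    goal : Formula
open Seq public

FreeInSeq : ℕ → Seq → Set
FreeInSeq x (Γ ⊢ δ) = FreeInCtx x Γ ⊎ FreeInF x δ

_≈_ : Seq → Seq → Set
(Γ ⊢ δ) ≈ (Γ' ⊢ δ') =
  ((φ : Formula) → φ ∈ Γ → φ ∈ Γ') × ((φ : Formula) → φ ∈ Γ' → φ ∈ Γ) × δ ≡ δ'

data Rule : List Seq → Seq → Set where
  ax    : ∀ φ → Rule [] (φ ∷ [] ⊢ φ)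
  ⊥L    : ∀ δ → Rule [] (⊥' ∷ [] ⊢ δ)
  ∧R    : ∀ Γ φ ψ → Rule ((Γ ⊢ φ) ∷ (Γ ⊢ ψ) ∷ []) (Γ ⊢ φ ∧' ψ)
  ∧L    : ∀ Γ φ ψ δ → Rule ((φ ∷ ψ ∷ Γ ⊢ δ) ∷ []) ((φ ∧' ψ) ∷ Γ ⊢ δ)
  ∨R₁   : ∀ Γ φ ψ → Rule ((Γ ⊢ φ) ∷ []) (Γ ⊢ φ ∨' ψ)
  ∨R₂   : ∀ Γ φ ψ → Rule ((Γ ⊢ ψ) ∷ []) (Γ ⊢ φ ∨' ψ)
  ∨L    : ∀ Γ φ ψ δ → Rule ((φ ∷ Γ ⊢ δ) ∷ (ψ ∷ Γ ⊢ δ) ∷ []) ((φ ∨' ψ) ∷ Γ ⊢ δ)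
  ⇒R    : ∀ Γ φ ψ → Rule ((φ ∷ Γ ⊢ ψ) ∷ []) (Γ ⊢ φ ⇒' ψ)
  ⇒L    : ∀ Γ φ ψ δ → Rule ((Γ ⊢ φ) ∷ (ψ ∷ Γ ⊢ δ) ∷ []) ((φ ⇒' ψ) ∷ Γ ⊢ δ)
  ∀R    : ∀ Γ x y φ → ¬ FreeInCtx y Γ → ¬ FreeInF y (∀' x φ) → FreeFor (var y) x φ →
          Rule ((Γ ⊢ substF (var y) x φ) ∷ []) (Γ ⊢ ∀' x φ)
  ∀L    : ∀ Γ x t φ δ → FreeFor t x φ →
          Rule ((substF t x φ ∷ Γ ⊢ δ) ∷ []) (∀' x φ ∷ Γ ⊢ δ)
  ∃R    : ∀ Γ x t φ → FreeFor t x φ →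
          Rule ((Γ ⊢ substF t x φ) ∷ []) (Γ ⊢ ∃' x φ)
  ∃L    : ∀ Γ x y φ δ → ¬ FreeInCtx y Γ → ¬ FreeInF y (∃' x φ) → ¬ FreeInF y δ →
          FreeFor (var y) x φ →
          Rule ((substF (var y) x φ ∷ Γ ⊢ δ) ∷ []) (∃' x φ ∷ Γ ⊢ δ)
  =R    : ∀ t → Rule [] ([] ⊢ t ≐ t)
  =L    : ∀ s t x φ → FreeFor s x φ → FreeFor t x φ →
          Rule [] ((s ≐ t) ∷ substF s x φ ∷ [] ⊢ substF t x φ)
  wk    : ∀ Γ Γ' δ → Rule ((Γ ⊢ δ) ∷ []) (Γ ++ Γ' ⊢ δ)
  cut   : ∀ Γ φ δ → Rule ((Γ ⊢ φ) ∷ (φ ∷ Γ ⊢ δ) ∷ []) (Γ ⊢ δ)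
  ax-0≠S  : ∀ t → Rule [] ([] ⊢ `0 ≠ `S t)
  ax-Sinj : ∀ s t → Rule [] ((`S s ≐ `S t) ∷ [] ⊢ s ≐ t)
  ax-+0   : ∀ s → Rule [] ([] ⊢ (s `+ `0) ≐ s)
  ax-+S   : ∀ s t → Rule [] ([] ⊢ (s `+ `S t) ≐ `S (s `+ t))
  ax-·0   : ∀ s → Rule [] ([] ⊢ (s `· `0) ≐ `0)
  ax-·S   : ∀ s t → Rule [] ([] ⊢ (s `· `S t) ≐ ((s `· t) `+ s))
  case  : ∀ x Γ δ →
          Rule ((substC `0 x Γ ⊢ substF `0 x δ) ∷
                (substC (`S (var x)) x Γ ⊢ substF (`S (var x)) x δ) ∷ []) (Γ ⊢ δ)

data Tree : Set where
  node : Seq → List Tree → Tree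

rootLabel : Tree → Seq
rootLabel (node s _) = s

kids : Tree → List Tree
kids (node _ ts) = ts

data Pos : Tree → Set where
  here  : ∀ {s ts} → Pos (node s ts)
  child : ∀ {s ts} (i : Fin (length ts)) → Pos (lookup ts i) → Pos (node s ts)

rootPos : (t : Tree) → Pos t
rootPos (node s ts) = here

subtree : ∀ {t} → Pos t → Tree
subtree {t} here     = t
subtree (child i p)  = subtree p

label : ∀ {t} → Pos t → Seq
label p = rootLabel (subtree p)

data IsChild : ∀ {t} → Pos t → Pos t → Set where
  top  : ∀ {s ts} (i : Fin (length ts)) →
         IsChild {node s ts} here (child i (rootPos (lookup ts i)))
  down : ∀ {s ts} (i : Fin (length ts)) {p q} →
         IsChild p q → IsChild {node s ts} (child i p) (child i q)

-- Pre-proofs ((T, β), ρ).  A node is either a bud (with β-value its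
-- companion) or carries a rule instance (ρ).

data Role (t : Tree) : Set where
  bud : Pos t → Role t
  inf : ∀ {ps c} → Rule ps c → Role t

data IsCase (x : ℕ) {t : Tree} : Role t → Set where
  is-case : ∀ {Γ δ} → IsCase x (inf (case x Γ δ))

record PreProof : Set where
  field
    tree : Tree
    role : Pos tree → Role tree
    bud-leaf   : ∀ {p c} → role p ≡ bud c → kids (subtree p) ≡ []
    comp-inner : ∀ {p c} → role p ≡ bud c → kids (subtree c) ≢ []
    bud-label  : ∀ {p c} → role p ≡ bud c → label p ≈ label c
    rule-prem  : ∀ {p ps c} {r : Rule ps c} → role p ≡ inf r →
                 Pointwise _≈_ ps (map rootLabel (kids (subtree p)))
    rule-concl : ∀ {p ps c} {r : Rule ps c} → role p ≡ inf r → c ≈ label p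
open PreProof public

rootSeq : PreProof → Seq
rootSeq P = rootLabel (tree P)

record InfBranch (P : PreProof) : Set where
  field
    v     : ℕ → Pos (tree P)
    start : v 0 ≡ rootPos (tree P)
    step  : ∀ i → IsChild (v i) (v (ℕ.suc i)) ⊎ role P (v i) ≡ bud (v (ℕ.suc i))
open InfBranch public

IsCHAProof : PreProof → Set
IsCHAProof P =
  (b : InfBranch P) → ∃ λ (x : ℕ) → ∃ λ (N : ℕ) →
    ((i : ℕ) → N ≤ i → FreeInSeq x (label (v b i))) ×
    ((i : ℕ) → ∃ λ (j : ℕ) → i ≤ j × IsCase x (role P (v b j)))

CHA⊢ : Seq → Set
CHA⊢ s = Σ PreProof λ P → IsCHAProof P × rootSeq P ≈ s

InjectiveBuds : PreProof → Set
InjectiveBuds P = ∀ {p q c} → role P p ≡ bud c → role P q ≡ bud c → p ≡ q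

-- Above every node of the given cyclic proof P insert a chain of M trivial weakening steps
-- Γ ⇒ δ / Γ ⇒ δ, where M is the number of nodes of P, and redirect each bud b with companion c
-- to the copy of c at depth index(b) of that chain, for an injective numbering index of the nodes;
-- distinct buds then have distinct companions. An infinite branch of the padded proof only
-- stutters along the chains, for at most M steps at a time, before it takes a step of P. Erasing
-- the stutter gives an infinite branch of P through the same sequents and the same Case instances,
-- so the trace condition transfers.

module Submission where

open import Defs
open import Data.Product using (Σ; _×_; _,_; proj₁; proj₂; uncurry)
open import Data.Product.Properties using (,-injective)
open import Data.Nat using (ℕ; zero; suc; _+_; _∸_; _≤_; _<_; z≤n; s≤s; _<?_)
open import Data.Nat.Properties
open import Data.Fin using (Fin; zero; suc; toℕ)
open import Data.Fin.Properties using (toℕ<n; toℕ-injective)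
open import Data.List using (List; []; _∷_; _++_; map; length; lookup)
open import Data.List.Properties using (++-identityʳ)
open import Data.List.Membership.Propositional using (_∈_)
open import Data.List.Membership.Propositional.Properties using (∈-++⁺ˡ; ∈-++⁺ʳ; ∈-map⁺)
open import Data.List.Relation.Unary.Any as Any using (index)
open import Data.List.Relation.Unary.Any.Properties using (lookup-index)
open import Data.List.Relation.Binary.Pointwise using (Pointwise; []; _∷_)
open import Data.Sum using (_⊎_; inj₁; inj₂; map₁)
open import Relation.Nullary using (yes; no; contradiction)
open import Relation.Binary.PropositionalEquality
open import Function using (_∘_)

shift : ∀ {s t ts} → Pos (node s ts) → Pos (node s (t ∷ ts))
shift here        = here
shift (child i p) = child (suc i) p

mutual
  positions : (t : Tree) → List (Pos t)
  positions (node s ts) = here ∷ childPositions ts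

  childPositions : ∀ {s} ts → List (Pos (node s ts))
  childPositions []       = []
  childPositions (t ∷ ts) = map (child zero) (positions t) ++ map shift (childPositions ts)

mutual
  ∈-positions : ∀ {t} (p : Pos t) → p ∈ positions t
  ∈-positions here        = Any.here refl
  ∈-positions (child i p) = Any.there (∈-childPositions _ i p)

  ∈-childPositions : ∀ {s} ts i p → child {s} {ts} i p ∈ childPositions ts
  ∈-childPositions (t ∷ ts) zero    p = ∈-++⁺ˡ (∈-map⁺ (child zero) (∈-positions p))
  ∈-childPositions (t ∷ ts) (suc i) p =
    ∈-++⁺ʳ (map (child zero) (positions t)) (∈-map⁺ shift (∈-childPositions ts i p))

positionIndex : ∀ {t} → Pos t → Fin (length (positions t))
positionIndex p = index (∈-positions p)

positionIndex-injective : ∀ {t} {p q : Pos t} → positionIndex p ≡ positionIndex q → p ≡ q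
positionIndex-injective {t} {p} {q} eq = begin
  p                                    ≡⟨ lookup-index (∈-positions p) ⟩
  lookup (positions t) (positionIndex p) ≡⟨ cong (lookup (positions t)) eq ⟩
  lookup (positions t) (positionIndex q) ≡⟨ lookup-index (∈-positions q) ⟨
  q                                    ∎
  where open ≡-Reasoning

tower : ℕ → Seq → Tree → Tree
tower zero    s u = u
tower (suc k) s u = node s (tower k s u ∷ [])

towerPos : ∀ k {s u} → ℕ → Pos u → Pos (tower k s u)
towerPos zero    d       x = x
towerPos (suc k) zero    x = here
towerPos (suc k) (suc d) x = child zero (towerPos k d x)

untowerPos : ∀ k {s u} → Pos (tower k s u) → ℕ ⊎ Pos u
untowerPos zero    q                   = inj₂ q
untowerPos (suc k) here                = inj₁ zero
untowerPos (suc k) (child zero q)      = map₁ suc (untowerPos k q)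
untowerPos (suc k) (child (suc ()) q)

untowerPos-storey : ∀ k {s u} d (x : Pos u) → d < k → untowerPos k {s} (towerPos k d x) ≡ inj₁ d
untowerPos-storey (suc k) zero    x _         = refl
untowerPos-storey (suc k) (suc d) x (s≤s d<k) = cong (map₁ suc) (untowerPos-storey k d x d<k)

untowerPos-base : ∀ k {s u} d (x : Pos u) → k ≤ d → untowerPos k {s} (towerPos k d x) ≡ inj₂ x
untowerPos-base zero    d       x _         = refl
untowerPos-base (suc k) (suc d) x (s≤s k≤d) = cong (map₁ suc) (untowerPos-base k d x k≤d)

towerPos-untowerPos-storey : ∀ k {s u} (q : Pos (tower k s u)) {d} → untowerPos k q ≡ inj₁ d →
                             d < k × (∀ x → towerPos k d x ≡ q)
towerPos-untowerPos-storey (suc k) here refl = s≤s z≤n , λ _ → refl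
towerPos-untowerPos-storey (suc k) (child zero q) eq with untowerPos k q in eq′
towerPos-untowerPos-storey (suc k) (child zero q) refl | inj₁ d =
  let d<k , at = towerPos-untowerPos-storey k q eq′ in s≤s d<k , λ x → cong (child zero) (at x)
towerPos-untowerPos-storey (suc k) (child zero q) ()   | inj₂ _
towerPos-untowerPos-storey (suc k) (child (suc ()) q) _

towerPos-untowerPos-base : ∀ k {s u} (q : Pos (tower k s u)) {x} → untowerPos k q ≡ inj₂ x →
                           towerPos k k x ≡ q
towerPos-untowerPos-base zero    q    refl = refl
towerPos-untowerPos-base (suc k) here ()
towerPos-untowerPos-base (suc k) (child zero q) eq with untowerPos k q in eq′
towerPos-untowerPos-base (suc k) (child zero q) ()   | inj₁ _
towerPos-untowerPos-base (suc k) (child zero q) refl | inj₂ x = cong (child zero) (towerPos-untowerPos-base k q eq′)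
towerPos-untowerPos-base (suc k) (child (suc ()) q) _

subtree-towerPos-root : ∀ k d {s} u → subtree (towerPos k {s} d (rootPos u)) ≡ tower (k ∸ d) s u
subtree-towerPos-root zero    zero    (node _ _) = refl
subtree-towerPos-root zero    (suc d) (node _ _) = refl
subtree-towerPos-root (suc k) zero    u          = refl
subtree-towerPos-root (suc k) (suc d) u          = subtree-towerPos-root k d u

subtree-towerPos-base : ∀ k {s u} d (x : Pos u) → k ≤ d → subtree (towerPos k {s} d x) ≡ subtree x
subtree-towerPos-base zero    d       x _         = refl
subtree-towerPos-base (suc k) (suc d) x (s≤s k≤d) = subtree-towerPos-base k d x k≤d

rootLabel-tower : ∀ k s ts → rootLabel (tower k s (node s ts)) ≡ s
rootLabel-tower zero    s ts = refl
rootLabel-tower (suc k) s ts = refl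

rootPos-tower : ∀ k {s u} → rootPos (tower k s u) ≡ towerPos k 0 (rootPos u)
rootPos-tower zero    = refl
rootPos-tower (suc k) = refl

IsChild-towerPos-storey : ∀ k {s u} d {q} → d < k → IsChild (towerPos k {s} {u} d (rootPos u)) q →
                          q ≡ towerPos k (suc d) (rootPos u)
IsChild-towerPos-storey (suc k) zero    _         (top zero)   = cong (child zero) (rootPos-tower k)
IsChild-towerPos-storey (suc k) (suc d) (s≤s d<k) (down zero c) = cong (child zero) (IsChild-towerPos-storey k d d<k c)

IsChild-towerPos-base : ∀ k {s u} (x : Pos u) {q} → IsChild (towerPos k {s} k x) q →
                        Σ (Pos u) λ x′ → q ≡ towerPos k k x′ × IsChild x x′
IsChild-towerPos-base zero    x c             = _ , refl , c
IsChild-towerPos-base (suc k) x (down zero c) =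
  let x′ , eq , c′ = IsChild-towerPos-base k x c in x′ , cong (child zero) eq , c′

module Padding (M : ℕ) where

  mutual
    pad : Tree → Tree
    pad (node s ts) = tower M s (node s (padList ts))

    padList : List Tree → List Tree
    padList []       = []
    padList (t ∷ ts) = pad t ∷ padList ts

  padNode : Tree → Tree
  padNode t = node (rootLabel t) (padList (kids t))

  paddedSubtree : ∀ {t} → Pos t → ℕ → Tree
  paddedSubtree p k = tower k (label p) (padNode (subtree p))

  padIndex : ∀ ts → Fin (length ts) → Fin (length (padList ts))
  padIndex (t ∷ ts) zero    = zero
  padIndex (t ∷ ts) (suc i) = suc (padIndex ts i)

  castPos : ∀ ts i → Pos (pad (lookup ts i)) → Pos (lookup (padList ts) (padIndex ts i))
  castPos (t ∷ ts) zero    y = y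
  castPos (t ∷ ts) (suc i) y = castPos ts i y

  castPos⁻¹ : ∀ ts i → Pos (lookup (padList ts) (padIndex ts i)) → Pos (pad (lookup ts i))
  castPos⁻¹ (t ∷ ts) zero    y = y
  castPos⁻¹ (t ∷ ts) (suc i) y = castPos⁻¹ ts i y

  castPos-castPos⁻¹ : ∀ ts i z → castPos ts i (castPos⁻¹ ts i z) ≡ z
  castPos-castPos⁻¹ (t ∷ ts) zero    z = refl
  castPos-castPos⁻¹ (t ∷ ts) (suc i) z = castPos-castPos⁻¹ ts i z

  subtree-castPos : ∀ ts i y → subtree (castPos ts i y) ≡ subtree y
  subtree-castPos (t ∷ ts) zero    y = refl
  subtree-castPos (t ∷ ts) (suc i) y = subtree-castPos ts i y

  IsChild-castPos : ∀ ts i {y z} → IsChild (castPos ts i y) z → IsChild y (castPos⁻¹ ts i z)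
  IsChild-castPos (t ∷ ts) zero    c = c
  IsChild-castPos (t ∷ ts) (suc i) c = IsChild-castPos ts i c

  -- Node p at depth d: depths d < M are the inserted copies above p, depth M is p itself.
  padPos : ∀ {t} → Pos t → ℕ → Pos (pad t)
  padPos {node s ts} here        d = towerPos M d here
  padPos {node s ts} (child i p) d = towerPos M M (child (padIndex ts i) (castPos ts i (padPos p d)))

  Child : List Tree → Set
  Child ts = Σ (Fin (length ts)) λ i → Pos (lookup ts i)

  mutual
    unpad : ∀ {t} → Pos (pad t) → Pos t × ℕ
    unpad {node s ts} q = unpadTower ts (untowerPos M q)

    unpadTower : ∀ {s} ts → ℕ ⊎ Pos (node s (padList ts)) → Pos (node s ts) × ℕ
    unpadTower ts (inj₁ d)           = here , d
    unpadTower ts (inj₂ here)        = here , M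
    unpadTower ts (inj₂ (child j z)) = let (i , p) , d = unpadChild ts j z in child i p , d

    unpadChild : ∀ ts j → Pos (lookup (padList ts) j) → Child ts × ℕ
    unpadChild (t ∷ ts) zero    z = let p , d = unpad {t} z in (zero , p) , d
    unpadChild (t ∷ ts) (suc j) z = let (i , p) , d = unpadChild ts j z in (suc i , p) , d

  padChild : ∀ {s} ts → Child ts × ℕ → Pos (node s (padList ts))
  padChild ts ((i , p) , d) = child (padIndex ts i) (castPos ts i (padPos p d))

  mutual
    unpad-padPos : ∀ {t} (p : Pos t) d → d ≤ M → unpad (padPos p d) ≡ (p , d)
    unpad-padPos {node s ts} here d d≤M with m≤n⇒m<n∨m≡n d≤M
    ... | inj₁ d<M rewrite untowerPos-storey M {s} d (here {s} {padList ts}) d<M = refl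
    ... | inj₂ refl rewrite untowerPos-base M {s} d (here {s} {padList ts}) ≤-refl = refl
    unpad-padPos {node s ts} (child i p) d d≤M =
      trans (cong (unpadTower ts) (untowerPos-base M M (padChild ts ((i , p) , d)) ≤-refl))
            (cong (λ ((i , p) , d) → child i p , d) (unpadChild-castPos ts i p d d≤M))

    unpadChild-castPos : ∀ ts i (p : Pos (lookup ts i)) d → d ≤ M →
                         unpadChild ts (padIndex ts i) (castPos ts i (padPos p d)) ≡ ((i , p) , d)
    unpadChild-castPos (t ∷ ts) zero    p d d≤M rewrite unpad-padPos p d d≤M = refl
    unpadChild-castPos (t ∷ ts) (suc i) p d d≤M rewrite unpadChild-castPos ts i p d d≤M = refl

  mutual
    padPos-unpad : ∀ {t} (q : Pos (pad t)) → uncurry padPos (unpad {t} q) ≡ q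
    padPos-unpad {node s ts} q with untowerPos M q in eq
    ... | inj₁ d           = proj₂ (towerPos-untowerPos-storey M q eq) here
    ... | inj₂ here        = towerPos-untowerPos-base M q eq
    ... | inj₂ (child j z) =
      trans (cong (towerPos M M) (padChild-unpadChild ts j z)) (towerPos-untowerPos-base M q eq)

    padChild-unpadChild : ∀ {s} ts j z → padChild {s} ts (unpadChild ts j z) ≡ child j z
    padChild-unpadChild (t ∷ ts) zero    z = cong (child zero) (padPos-unpad {t} z)
    padChild-unpadChild (t ∷ ts) (suc j) z = cong shift (padChild-unpadChild ts j z)

  mutual
    unpad-≤ : ∀ {t} (q : Pos (pad t)) → proj₂ (unpad {t} q) ≤ M
    unpad-≤ {node s ts} q with untowerPos M q in eq
    ... | inj₁ d           = <⇒≤ (proj₁ (towerPos-untowerPos-storey M q eq))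
    ... | inj₂ here        = ≤-refl
    ... | inj₂ (child j z) = unpadChild-≤ ts j z

    unpadChild-≤ : ∀ ts j z → proj₂ (unpadChild ts j z) ≤ M
    unpadChild-≤ (t ∷ ts) zero    z = unpad-≤ {t} z
    unpadChild-≤ (t ∷ ts) (suc j) z = unpadChild-≤ ts j z

  padPos-injective : ∀ {t} {p p′ : Pos t} {d d′} → d ≤ M → d′ ≤ M →
                     padPos p d ≡ padPos p′ d′ → p ≡ p′ × d ≡ d′
  padPos-injective {p = p} {p′} {d} {d′} d≤M d′≤M eq =
    ,-injective (trans (sym (unpad-padPos p d d≤M)) (trans (cong unpad eq) (unpad-padPos p′ d′ d′≤M)))

  data Unpadded {t} : Pos (pad t) → Set where
    storey : (p : Pos t) {d : ℕ} → d < M → Unpadded (padPos p d)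
    base   : (p : Pos t) → Unpadded (padPos p M)

  unpadded : ∀ {t} (q : Pos (pad t)) → Unpadded q
  unpadded {t} q = subst (Unpadded {t}) (padPos-unpad {t} q) (layer (unpad-≤ {t} q))
    where
    layer : ∀ {p : Pos t} {d} → d ≤ M → Unpadded (padPos p d)
    layer {p} d≤M with m≤n⇒m<n∨m≡n d≤M
    ... | inj₁ d<M  = storey p d<M
    ... | inj₂ refl = base p

  subtree-padPos : ∀ {t} (p : Pos t) d → subtree (padPos p d) ≡ paddedSubtree p (M ∸ d)
  subtree-padPos {node s ts} here        d = subtree-towerPos-root M d (node s (padList ts))
  subtree-padPos {node s ts} (child i p) d = begin
    subtree (towerPos M M (padChild ts ((i , p) , d))) ≡⟨ subtree-towerPos-base M M _ ≤-refl ⟩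
    subtree (castPos ts i (padPos p d))                 ≡⟨ subtree-castPos ts i (padPos p d) ⟩
    subtree (padPos p d)                                ≡⟨ subtree-padPos p d ⟩
    paddedSubtree p (M ∸ d)                             ∎
    where open ≡-Reasoning

  label-padPos : ∀ {t} (p : Pos t) d → label (padPos p d) ≡ label p
  label-padPos p d = trans (cong rootLabel (subtree-padPos p d)) (rootLabel-tower (M ∸ d) (label p) _)

  label-unpad : ∀ {t} (q : Pos (pad t)) → label q ≡ label (proj₁ (unpad {t} q))
  label-unpad {t} q = trans (cong label (sym (padPos-unpad {t} q))) (label-padPos (proj₁ (unpad {t} q)) _)

  kids-padPos-storey : ∀ {t} (p : Pos t) {d} → d < M →
                       kids (subtree (padPos p d)) ≡ subtree (padPos p (suc d)) ∷ []
  kids-padPos-storey p {d} d<M = begin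
    kids (subtree (padPos p d))      ≡⟨ cong kids (subtree-padPos p d) ⟩
    kids (paddedSubtree p (M ∸ d))   ≡⟨ cong (kids ∘ paddedSubtree p) (+-∸-assoc 1 d<M) ⟩
    paddedSubtree p (M ∸ suc d) ∷ [] ≡⟨ cong (_∷ []) (subtree-padPos p (suc d)) ⟨
    subtree (padPos p (suc d)) ∷ []  ∎
    where open ≡-Reasoning

  kids-padPos-base : ∀ {t} (p : Pos t) → kids (subtree (padPos p M)) ≡ padList (kids (subtree p))
  kids-padPos-base p = trans (cong kids (subtree-padPos p M)) (cong (kids ∘ paddedSubtree p) (n∸n≡0 M))

  rootLabel-pad : ∀ t → rootLabel (pad t) ≡ rootLabel t
  rootLabel-pad (node s ts) = rootLabel-tower M s (padList ts)

  map-rootLabel-padList : ∀ ts → map rootLabel (padList ts) ≡ map rootLabel ts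
  map-rootLabel-padList []       = refl
  map-rootLabel-padList (t ∷ ts) = cong₂ _∷_ (rootLabel-pad t) (map-rootLabel-padList ts)

  rootPos-pad : ∀ t → rootPos (pad t) ≡ padPos (rootPos t) 0
  rootPos-pad (node s ts) = rootPos-tower M

  IsChild-padPos-child : ∀ {s ts} i (p : Pos (lookup ts i)) d {q} → IsChild (padPos {node s ts} (child i p) d) q →
                         Σ (Pos (pad (lookup ts i))) λ z →
                           IsChild (padPos p d) z × q ≡ towerPos M M (child (padIndex ts i) (castPos ts i z))
  IsChild-padPos-child {s} {ts} i p d c with IsChild-towerPos-base M _ c
  ... | child _ z , refl , down _ c′ =
    castPos⁻¹ ts i z , IsChild-castPos ts i c′ ,
    cong (λ z → towerPos M M (child _ z)) (sym (castPos-castPos⁻¹ ts i z))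

  IsChild-padPos-storey : ∀ {t} (p : Pos t) {d q} → d < M → IsChild (padPos p d) q → q ≡ padPos p (suc d)
  IsChild-padPos-storey {node s ts} here        d<M c = IsChild-towerPos-storey M _ d<M c
  IsChild-padPos-storey {node s ts} (child i p) d<M c with IsChild-padPos-child i p _ c
  ... | z , c′ , refl rewrite IsChild-padPos-storey p d<M c′ = refl

  padPos-root-child : ∀ {s} ts j → Σ (Fin (length ts)) λ i →
                      child {s} {padList ts} j (rootPos (lookup (padList ts) j))
                        ≡ padChild ts ((i , rootPos (lookup ts i)) , 0)
  padPos-root-child (t ∷ ts) zero    = zero , cong (child zero) (rootPos-pad t)
  padPos-root-child (t ∷ ts) (suc j) = let i , eq = padPos-root-child ts j in suc i , cong shift eq

  IsChild-padPos-base : ∀ {t} (p : Pos t) {q} → IsChild (padPos p M) q →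
                        Σ (Pos t) λ p′ → IsChild p p′ × q ≡ padPos p′ 0
  IsChild-padPos-base {node s ts} here c with IsChild-towerPos-base M here c
  ... | _ , refl , top j = let i , eq = padPos-root-child ts j in
    child i (rootPos (lookup ts i)) , top i , cong (towerPos M M) eq
  IsChild-padPos-base {node s ts} (child i p) c with IsChild-padPos-child i p M c
  ... | z , c′ , refl with IsChild-padPos-base p c′
  ... | p′ , c″ , refl = child i p′ , down i c″ , refl

module Countdown (c : ℕ → ℕ) (tick : ∀ {i n} → c i ≡ suc n → c (suc i) ≡ n) where

  countdown-ind : (P : ℕ → Set) → (∀ {i} → c i ≡ 0 → P i) →
                  (∀ {i n} → c i ≡ suc n → P (suc i) → P i) → ∀ i → P i
  countdown-ind P done next i = go (c i) i refl
    where
    go : ∀ n i → c i ≡ n → P i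
    go zero    i eq = done eq
    go (suc n) i eq = next eq (go n (suc i) (tick eq))

  reach : ℕ → ℕ
  reach i = i + c i

  ≤-reach : ∀ i → i ≤ reach i
  ≤-reach i = m≤m+n i (c i)

  reach-done : ∀ {i} → c i ≡ 0 → reach i ≡ i
  reach-done {i} eq = trans (cong (i +_) eq) (+-identityʳ i)

  reach-next : ∀ {i n} → c i ≡ suc n → reach (suc i) ≡ reach i
  reach-next {i} {n} eq = begin
    suc i + c (suc i) ≡⟨ cong (suc i +_) (tick eq) ⟩
    suc (i + n)       ≡⟨ +-suc i n ⟨
    i + suc n         ≡⟨ cong (i +_) eq ⟨
    i + c i           ∎
    where open ≡-Reasoning

  c-reach : ∀ i → c (reach i) ≡ 0
  c-reach = countdown-ind (λ i → c (reach i) ≡ 0)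
    (λ eq → trans (cong c (reach-done eq)) eq)
    (λ eq ih → trans (cong c (sym (reach-next eq))) ih)

  reach-stable : {A : Set} (f : ℕ → A) → (∀ {i n} → c i ≡ suc n → f (suc i) ≡ f i) →
                 ∀ i → f (reach i) ≡ f i
  reach-stable f f-next = countdown-ind (λ i → f (reach i) ≡ f i)
    (λ eq → cong f (reach-done eq))
    (λ eq ih → trans (cong f (sym (reach-next eq))) (trans ih (f-next eq)))

  zeros : ℕ → ℕ
  zeros zero    = reach 0
  zeros (suc k) = reach (suc (zeros k))

  c-zeros : ∀ k → c (zeros k) ≡ 0
  c-zeros zero    = c-reach 0
  c-zeros (suc k) = c-reach (suc (zeros k))

  zeros-<-suc : ∀ k → zeros k < zeros (suc k)
  zeros-<-suc k = ≤-reach (suc (zeros k))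

  zeros-< : ∀ {k k′} → k < k′ → zeros k < zeros k′
  zeros-< {k} {suc k′} (s≤s k≤k′) with m≤n⇒m<n∨m≡n k≤k′
  ... | inj₁ k<k′ = <-trans (zeros-< k<k′) (zeros-<-suc k′)
  ... | inj₂ refl = zeros-<-suc k

  zeros-≤⁻¹ : ∀ {k k′} → zeros k ≤ zeros k′ → k ≤ k′
  zeros-≤⁻¹ le = ≮⇒≥ λ k′<k → <⇒≱ (zeros-< k′<k) le

  ≤-zeros : ∀ k → k ≤ zeros k
  ≤-zeros zero    = z≤n
  ≤-zeros (suc k) = ≤-trans (s≤s (≤-zeros k)) (zeros-<-suc k)

  reach-zeros : ∀ i → Σ ℕ λ k → reach i ≡ zeros k
  reach-zeros zero    = 0 , refl
  reach-zeros (suc i) = next (c i) refl (reach-zeros i)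
    where
    next : ∀ n → c i ≡ n → Σ ℕ (λ k → reach i ≡ zeros k) → Σ ℕ λ k → reach (suc i) ≡ zeros k
    next zero    eq (k , r) = suc k , cong (reach ∘ suc) (trans (sym (reach-done eq)) r)
    next (suc n) eq (k , r) = k , trans (reach-next eq) r

trivialWeakening : ∀ s → Rule (s ∷ []) (ctx s ++ [] ⊢ goal s)
trivialWeakening s = wk (ctx s) [] (goal s)

Step : (P : PreProof) → Pos (tree P) → Pos (tree P) → Set
Step P p q = IsChild p q ⊎ role P p ≡ bud q

≡⇒≈ : ∀ {s s′} → s ≡ s′ → s ≈ s′
≡⇒≈ {_ ⊢ _} refl = (λ _ m → m) , (λ _ m → m) , refl

module Injectivised (P : PreProof) where

  T : Tree
  T = tree P

  M : ℕ
  M = length (positions T)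

  open Padding M

  budIndex : Pos T → ℕ
  budIndex p = toℕ (positionIndex p)

  budIndex<M : ∀ p → budIndex p < M
  budIndex<M p = toℕ<n (positionIndex p)

  budIndex-injective : ∀ {p q} → budIndex p ≡ budIndex q → p ≡ q
  budIndex-injective eq = positionIndex-injective (toℕ-injective eq)

  redirect : Pos T → Role T → Role (pad T)
  redirect p (bud c) = bud (padPos c (budIndex p))
  redirect p (inf r) = inf r

  redirect-bud⁻¹ : ∀ {p ρ c′} → redirect p ρ ≡ bud c′ →
                   Σ (Pos T) λ c → ρ ≡ bud c × c′ ≡ padPos c (budIndex p)
  redirect-bud⁻¹ {ρ = bud c} refl = c , refl , refl
  redirect-bud⁻¹ {ρ = inf _} ()

  redirect-inf⁻¹ : ∀ {p ρ ps c} {r : Rule ps c} → redirect p ρ ≡ inf r → ρ ≡ inf r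
  redirect-inf⁻¹ {ρ = bud _} ()
  redirect-inf⁻¹ {ρ = inf _} refl = refl

  IsCase-redirect : ∀ {x p ρ} → IsCase x ρ → IsCase x (redirect p ρ)
  IsCase-redirect is-case = is-case

  paddedRole : Pos T → ℕ → Role (pad T)
  paddedRole p d with d <? M
  ... | yes _ = inf (trivialWeakening (label p))
  ... | no  _ = redirect p (role P p)

  origin : Pos (pad T) → Pos T
  origin q = proj₁ (unpad {T} q)

  role′ : Pos (pad T) → Role (pad T)
  role′ q = uncurry paddedRole (unpad {T} q)

  role′-storey : ∀ (p : Pos T) {d} → d < M → role′ (padPos p d) ≡ inf (trivialWeakening (label p))
  role′-storey p {d} d<M rewrite unpad-padPos p d (<⇒≤ d<M) with d <? M
  ... | yes _   = refl
  ... | no  d≮M = contradiction d<M d≮M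

  role′-base : ∀ (p : Pos T) → role′ (padPos p M) ≡ redirect p (role P p)
  role′-base p rewrite unpad-padPos p M ≤-refl with M <? M
  ... | yes M<M = contradiction M<M (<-irrefl refl)
  ... | no  _   = refl

  padded-bud⁻¹ : ∀ {q c′} → role′ q ≡ bud c′ →
                 Σ (Pos T) λ p → Σ (Pos T) λ c →
                   q ≡ padPos p M × role P p ≡ bud c × c′ ≡ padPos c (budIndex p)
  padded-bud⁻¹ {q} eq with unpadded {T} q
  ... | storey p d<M = contradiction (trans (sym (role′-storey p d<M)) eq) λ ()
  ... | base p       = let c , e , e′ = redirect-bud⁻¹ (trans (sym (role′-base p)) eq) in p , c , refl , e , e′

  bud-leaf′ : ∀ {q c′} → role′ q ≡ bud c′ → kids (subtree q) ≡ []
  bud-leaf′ eq with padded-bud⁻¹ eq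
  ... | p , c , refl , e , _ = trans (kids-padPos-base p) (cong padList (bud-leaf P e))

  comp-inner′ : ∀ {q c′} → role′ q ≡ bud c′ → kids (subtree c′) ≢ []
  comp-inner′ eq with padded-bud⁻¹ eq
  ... | p , c , refl , _ , refl rewrite kids-padPos-storey c (budIndex<M p) = λ ()

  bud-label′ : ∀ {q c′} → role′ q ≡ bud c′ → label q ≈ label c′
  bud-label′ eq with padded-bud⁻¹ eq
  ... | p , c , refl , e , refl =
    subst₂ _≈_ (sym (label-padPos p M)) (sym (label-padPos c (budIndex p))) (bud-label P e)

  rule-prem′ : ∀ {q ps c} {r : Rule ps c} → role′ q ≡ inf r →
               Pointwise _≈_ ps (map rootLabel (kids (subtree q)))
  rule-prem′ {q} eq with unpadded {T} q
  ... | storey p {d} d<M = weakening (trans (sym (role′-storey p d<M)) eq)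
    where
    weakening : ∀ {ps c} {r : Rule ps c} → inf (trivialWeakening (label p)) ≡ inf r →
                Pointwise _≈_ ps (map rootLabel (kids (subtree (padPos p d))))
    weakening refl rewrite kids-padPos-storey p d<M = ≡⇒≈ (sym (label-padPos p (suc d))) ∷ []
  ... | base p =
    subst (Pointwise _≈_ _) (sym (trans (cong (map rootLabel) (kids-padPos-base p)) (map-rootLabel-padList _)))
          (rule-prem P (redirect-inf⁻¹ (trans (sym (role′-base p)) eq)))

  rule-concl′ : ∀ {q ps c} {r : Rule ps c} → role′ q ≡ inf r → c ≈ label q
  rule-concl′ {q} eq with unpadded {T} q
  ... | storey p {d} d<M = weakening (trans (sym (role′-storey p d<M)) eq)
    where
    weakening : ∀ {ps c} {r : Rule ps c} → inf (trivialWeakening (label p)) ≡ inf r →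
                c ≈ label (padPos p d)
    weakening refl =
      ≡⇒≈ (trans (cong (_⊢ goal (label p)) (++-identityʳ (ctx (label p)))) (sym (label-padPos p d)))
  ... | base p =
    subst (_ ≈_) (sym (label-padPos p M)) (rule-concl P (redirect-inf⁻¹ (trans (sym (role′-base p)) eq)))

  padded : PreProof
  padded = record
    { tree       = pad T
    ; role       = role′
    ; bud-leaf   = bud-leaf′
    ; comp-inner = comp-inner′
    ; bud-label  = bud-label′
    ; rule-prem  = rule-prem′
    ; rule-concl = rule-concl′
    }

  rootSeq-padded : rootSeq padded ≡ rootSeq P
  rootSeq-padded = rootLabel-pad T

  injectiveBuds : InjectiveBuds padded
  injectiveBuds e₁ e₂ with padded-bud⁻¹ e₁ | padded-bud⁻¹ e₂
  ... | p₁ , c₁ , refl , _ , refl | p₂ , c₂ , refl , _ , eq =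
    cong (λ p → padPos p M) (budIndex-injective
      (proj₂ (padPos-injective {T} (<⇒≤ (budIndex<M p₁)) (<⇒≤ (budIndex<M p₂)) eq)))

  step-storey : ∀ (p : Pos T) {d q} → d < M → Step padded (padPos p d) q → q ≡ padPos p (suc d)
  step-storey p d<M (inj₁ c) = IsChild-padPos-storey p d<M c
  step-storey p d<M (inj₂ e) = contradiction (trans (sym (role′-storey p d<M)) e) λ ()

  step-base : ∀ (p : Pos T) {q} → Step padded (padPos p M) q → Step P p (origin q)
  step-base p (inj₁ c) with IsChild-padPos-base p c
  ... | p′ , c′ , refl rewrite unpad-padPos p′ 0 z≤n = inj₁ c′
  step-base p (inj₂ e) with redirect-bud⁻¹ (trans (sym (role′-base p)) e)
  ... | c , e′ , refl rewrite unpad-padPos c (budIndex p) (<⇒≤ (budIndex<M p)) = inj₂ e′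

  module Projection (b : InfBranch padded) where

    pos : ℕ → Pos T
    pos i = origin (v b i)

    depth : ℕ → ℕ
    depth i = proj₂ (unpad {T} (v b i))

    v≡padPos : ∀ i → v b i ≡ padPos (pos i) (depth i)
    v≡padPos i = sym (padPos-unpad {T} (v b i))

    step-padPos : ∀ i → Step padded (padPos (pos i) (depth i)) (v b (suc i))
    step-padPos i = subst (λ q → Step padded q (v b (suc i))) (v≡padPos i) (step b i)

    climb : ∀ {i} → depth i < M → unpad {T} (v b (suc i)) ≡ (pos i , suc (depth i))
    climb {i} lt = trans (cong (unpad {T}) (step-storey (pos i) lt (step-padPos i))) (unpad-padPos (pos i) _ lt)

    -- The number of steps left before the branch reaches an original node of P.
    remaining : ℕ → ℕ
    remaining i = M ∸ depth i

    remaining-suc⇒< : ∀ {i n} → remaining i ≡ suc n → depth i < M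
    remaining-suc⇒< eq = m∸n≢0⇒n<m λ eq′ → 0≢1+n (trans (sym eq′) eq)

    remaining-tick : ∀ {i n} → remaining i ≡ suc n → remaining (suc i) ≡ n
    remaining-tick {i} {n} eq = suc-injective (begin
      suc (M ∸ depth (suc i)) ≡⟨ cong (λ d → suc (M ∸ d)) (cong proj₂ (climb lt)) ⟩
      suc (M ∸ suc (depth i)) ≡⟨ +-∸-assoc 1 lt ⟨
      M ∸ depth i             ≡⟨ eq ⟩
      suc n                   ∎)
      where
      open ≡-Reasoning
      lt = remaining-suc⇒< eq

    open Countdown remaining remaining-tick public

    pos-reach : ∀ i → pos (reach i) ≡ pos i
    pos-reach = reach-stable pos λ eq → cong proj₁ (climb (remaining-suc⇒< eq))

    depth-zeros : ∀ k → depth (zeros k) ≡ M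
    depth-zeros k = ≤-antisym (unpad-≤ {T} (v b (zeros k))) (m∸n≡0⇒m≤n (c-zeros k))

    v-zeros : ∀ k → v b (zeros k) ≡ padPos (pos (zeros k)) M
    v-zeros k = trans (v≡padPos (zeros k)) (cong (padPos (pos (zeros k))) (depth-zeros k))

    projected : InfBranch P
    projected = record { v = pos ∘ zeros ; start = start′ ; step = step′ }
      where
      open ≡-Reasoning
      start′ : pos (zeros 0) ≡ rootPos T
      start′ = begin
        pos (reach 0)                 ≡⟨ pos-reach 0 ⟩
        origin (v b 0)                ≡⟨ cong origin (trans (start b) (rootPos-pad T)) ⟩
        origin (padPos (rootPos T) 0) ≡⟨ cong proj₁ (unpad-padPos (rootPos T) 0 z≤n) ⟩
        rootPos T                     ∎
      step′ : ∀ k → Step P (pos (zeros k)) (pos (zeros (suc k)))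
      step′ k rewrite pos-reach (suc (zeros k)) =
        step-base (pos (zeros k)) (subst (λ q → Step padded q (v b (suc (zeros k)))) (v-zeros k) (step b (zeros k)))

    label-v : ∀ i → Σ ℕ λ k → i ≤ zeros k × label (v b i) ≡ label (pos (zeros k))
    label-v i = let k , eq = reach-zeros i in
      k , ≤-trans (≤-reach i) (≤-reflexive eq) ,
      trans (label-unpad {T} (v b i)) (cong label (trans (sym (pos-reach i)) (cong pos eq)))

    role-zeros : ∀ k → role′ (v b (zeros k)) ≡ redirect (pos (zeros k)) (role P (pos (zeros k)))
    role-zeros k = trans (cong role′ (v-zeros k)) (role′-base (pos (zeros k)))

  isCHA-padded : IsCHAProof P → IsCHAProof padded
  isCHA-padded isCHA b with isCHA (Projection.projected b)
  ... | x , N , free , cases = x , zeros N , free′ , cases′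
    where
    open Projection b
    free′ : ∀ i → zeros N ≤ i → FreeInSeq x (label (v b i))
    free′ i N≤i = let k , i≤k , eq = label-v i in
      subst (FreeInSeq x) (sym eq) (free k (zeros-≤⁻¹ (≤-trans N≤i i≤k)))
    cases′ : ∀ i → Σ ℕ λ j → i ≤ j × IsCase x (role′ (v b j))
    cases′ i = let j , i≤j , case-j = cases i in
      zeros j , ≤-trans i≤j (≤-zeros j) , subst (IsCase x) (sym (role-zeros j)) (IsCase-redirect case-j)

lemma5p6 : (s : Seq) → CHA⊢ s →
    Σ PreProof (λ P → IsCHAProof P × InjectiveBuds P × rootSeq P ≈ s)
lemma5p6 s (P , isCHA , root≈s) =
  padded , isCHA-padded isCHA , injectiveBuds , subst (_≈ s) (sym rootSeq-padded) root≈s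
  where open Injectivised P
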